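{- For every base $\mathscr B$, finite multisets of atoms $S,T$ and IMLL formulas $\phi,\psi,\chi$: if $\Vdash^{S}_{\mathscr B}\phi\otimes\psi$ and $\phi,\psi\Vdash^{T}_{\mathscr B}\chi$, then $\Vdash^{S,T}_{\mathscr B}\chi$.
   Context: Fix a countably infinite set $\mathbb{A}$ of atoms. IMLL formulas: $\phi::=p\in\mathbb A\mid\phi\otimes\phi\mid\mathrm I\mid\phi\multimap\phi$. $\Gamma,\Delta$ denote finite multisets of formulas, $P,S,T,U,V$ finite multisets of atoms, "$\Gamma,\Delta$" multiset union. An atomic rule is $(P_1\triangleright p_1,\dots,P_n\triangleright p_n)\Rightarrow p$ ($n\ge0$, $P_i$ finite multisets of atoms, $p_i,p$ atoms). A base is a (possibly infinite) set of atomic rules; $\mathscr C\supseteq\mathscr B$ means extension. Derivability $P\vdash_{\mathscr B}q$ is the least relation with: $[p]\vdash_{\mathscr B}p$ for every atom $p$; if $(P_1\triangleright p_1,\dots,P_n\triangleright p_n)\Rightarrow p\in\mathscr B$ and $S_i,P_i\vdash_{\mathscr B}p_i$ for $i=1,\dots,n$, then $S_1,\dots,S_n\vdash_{\mathscr B}p$. Support is defined inductively: $\Vdash^P_{\mathscr B}p$ iff $P\vdash_{\mathscr B}p$; $\Vdash^P_{\mathscr B}\phi\otimes\psi$ iff for every $\mathscr X\supseteq\mathscr B$, every $U$ and every atom $p$, if $\phi,\psi\Vdash^U_{\mathscr X}p$ then $\Vdash^{P,U}_{\mathscr X}p$; $\Vdash^P_{\mathscr B}\mathrm I$ iff for every $\mathscr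 X\supseteq\mathscr B$, $U$, atom $p$, if $\Vdash^U_{\mathscr X}p$ then $\Vdash^{P,U}_{\mathscr X}p$; $\Vdash^P_{\mathscr B}\phi\multimap\psi$ iff $\phi\Vdash^P_{\mathscr B}\psi$; for nonempty $\Gamma,\Delta$: $\Vdash^P_{\mathscr B}\Gamma,\Delta$ iff there are $U,V$ with $P=U,V$, $\Vdash^U_{\mathscr B}\Gamma$ and $\Vdash^V_{\mathscr B}\Delta$ (for a singleton $[\phi]$ this is $\Vdash^P_{\mathscr B}\phi$); for nonempty $\Gamma$: $\Gamma\Vdash^P_{\mathscr B}\phi$ iff for every $\mathscr X\supseteq\mathscr B$ and every $U$, if $\Vdash^U_{\mathscr X}\Gamma$ then $\Vdash^{P,U}_{\mathscr X}\phi$. -}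

module Defs where

open import Level using (Level; Lift; _⊔_) renaming (suc to lsuc; zero to lzero)
open import Data.Nat using (ℕ)
open import Data.List using (List; []; _∷_; _++_; [_])
open import Data.Product using (_×_; _,_; ∃; ∃-syntax)
open import Data.List.Relation.Binary.Permutation.Propositional using (_↭_)

Atom : Set
Atom = ℕ

-- Finite multisets are lists considered up to permutation (_↭_).
-- "P = U , V" is rendered as  P ↭ U ++ V.

infixr 6 _⊗_
infixr 5 _⊸_
data Formula : Set where
  atom : Atom → Formula
  _⊗_  : Formula → Formula → Formula
  I    : Formula
  _⊸_  : Formula → Formula → Formula

-- Atomic rule (P₁ ▷ p₁, …, Pₙ ▷ pₙ) ⇒ p : list of premises and a conclusion.
record Rule : Set where
  constructor _⇒_
  field
    premises   : List (List Atom × Atom)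
    conclusion : Atom

Base : Set₁
Base = Rule → Set

_⊇_ : Base → Base → Set
C ⊇ B = ∀ r → B r → C r

mutual
  data Derivable (B : Base) : List Atom → Atom → Set where
    ax  : ∀ {P p} → P ↭ [ p ] → Derivable B P p
    app : ∀ {prems p P} → B (prems ⇒ p) → DerivPremises B prems P → Derivable B P p

  -- DerivPremises B [(P₁,p₁),…,(Pₙ,pₙ)] S : there are S₁,…,Sₙ with
  -- S = S₁,…,Sₙ and Sᵢ,Pᵢ ⊢_ℬ pᵢ for each i.
  data DerivPremises (B : Base) : List (List Atom × Atom) → List Atom → Set where
    none : ∀ {S} → S ↭ [] → DerivPremises B [] S
    more : ∀ {Q q rest S₁ R S} → Derivable B (S₁ ++ Q) q → DerivPremises B rest R →
           S ↭ S₁ ++ R → DerivPremises B ((Q , q) ∷ rest) S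

mutual
  Sup : Base → List Atom → Formula → Set₁
  Sup B P (atom p) = Lift (lsuc lzero) (Derivable B P p)
  Sup B P (φ ⊗ ψ) = ∀ (X : Base) → X ⊇ B → ∀ (U : List Atom) (p : Atom) →
                    (∀ (Y : Base) → Y ⊇ X → ∀ (W : List Atom) → Sup₂ Y W φ ψ → Sup Y (U ++ W) (atom p)) →
                    Sup X (P ++ U) (atom p)
  Sup B P I = ∀ (X : Base) → X ⊇ B → ∀ (U : List Atom) (p : Atom) →
              Sup X U (atom p) → Sup X (P ++ U) (atom p)
  Sup B P (φ ⊸ ψ) = ∀ (X : Base) → X ⊇ B → ∀ (U : List Atom) → Sup X U φ → Sup X (P ++ U) ψ

  Sup₂ : Base → List Atom → Formula → Formula → Set₁
  Sup₂ B P φ ψ = ∃[ U ] ∃[ V ] (P ↭ U ++ V × Sup B U φ × Sup B V ψ)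

-- Support of a nonempty multiset of formulas (listed); for [] we take the
-- unit convention P ↭ [] (never used for the statement).
SupCtx : Base → List Atom → List Formula → Set₁
SupCtx B P [] = Lift (lsuc lzero) (P ↭ [])
SupCtx B P (φ ∷ []) = Sup B P φ
SupCtx B P (φ ∷ Γ@(_ ∷ _)) = ∃[ U ] ∃[ V ] (P ↭ U ++ V × Sup B U φ × SupCtx B V Γ)

Conseq : Base → List Atom → List Formula → Formula → Set₁
Conseq B P Γ φ = ∀ (X : Base) → X ⊇ B → ∀ (U : List Atom) → SupCtx X U Γ → Sup X (P ++ U) φ

-- Support of φ ⊗ ψ is defined by elimination into atoms only. For a general χ one inducts on χ:
-- a non-atomic χ is supported once it produces some conclusion from an extra context U at every
-- extension, so U can be moved into the continuation side, where the elimination is applied to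
-- an atom (χ = ξ ⊗ ζ or I) or, inductively, to ζ (χ = ξ ⊸ ζ).
module Submission where

open import Defs
open import Data.List using (List; []; _∷_; _++_)
open import Level using (lift)
open import Data.List.Relation.Binary.Permutation.Propositional
  using (_↭_; ↭-trans; ↭-sym; module PermutationReasoning)
open import Data.List.Relation.Binary.Permutation.Propositional.Properties
  using (++⁺ˡ; ++⁺ʳ; ++-assoc; ++-comm)

⊇-refl : ∀ {B} → B ⊇ B
⊇-refl r b = b

⊇-trans : ∀ {A B C} → C ⊇ B → B ⊇ A → C ⊇ A
⊇-trans c b r a = c r (b r a)

mutual
  Derivable-mono : ∀ {B C P p} → C ⊇ B → Derivable B P p → Derivable C P p
  Derivable-mono e (ax P↭p) = ax P↭p
  Derivable-mono e (app r ds) = app (e _ r) (DerivPremises-mono e ds)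

  DerivPremises-mono : ∀ {B C prems P} → C ⊇ B → DerivPremises B prems P → DerivPremises C prems P
  DerivPremises-mono e (none P↭[]) = none P↭[]
  DerivPremises-mono e (more d ds P↭) = more (Derivable-mono e d) (DerivPremises-mono e ds) P↭

Sup-mono : ∀ {B C P} χ → C ⊇ B → Sup B P χ → Sup C P χ
Sup-mono (atom p) e (lift d) = lift (Derivable-mono e d)
Sup-mono (χ ⊗ ξ)  e s X f = s X (⊇-trans f e)
Sup-mono I        e s X f = s X (⊇-trans f e)
Sup-mono (χ ⊸ ξ)  e s X f = s X (⊇-trans f e)

Derivable-resp-↭ : ∀ {B P Q p} → P ↭ Q → Derivable B P p → Derivable B Q p
Derivable-resp-↭ P↭Q (ax P↭p)                   = ax (↭-trans (↭-sym P↭Q) P↭p)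
Derivable-resp-↭ P↭Q (app r (none P↭[]))        = app r (none (↭-trans (↭-sym P↭Q) P↭[]))
Derivable-resp-↭ P↭Q (app r (more d ds P↭S++R)) = app r (more d ds (↭-trans (↭-sym P↭Q) P↭S++R))

Sup-resp-↭ : ∀ {B P Q} χ → P ↭ Q → Sup B P χ → Sup B Q χ
Sup-resp-↭ (atom p) P↭Q (lift d)       = lift (Derivable-resp-↭ P↭Q d)
Sup-resp-↭ (χ ⊗ ξ)  P↭Q s X e U p k    = Sup-resp-↭ (atom p) (++⁺ʳ U P↭Q) (s X e U p k)
Sup-resp-↭ I        P↭Q s X e U p k    = Sup-resp-↭ (atom p) (++⁺ʳ U P↭Q) (s X e U p k)
Sup-resp-↭ (χ ⊸ ξ)  P↭Q s X e U t      = Sup-resp-↭ ξ (++⁺ʳ U P↭Q) (s X e U t)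

reassoc : ∀ {B} (S T U : List Atom) χ → Sup B (S ++ (T ++ U)) χ → Sup B ((S ++ T) ++ U) χ
reassoc S T U χ = Sup-resp-↭ χ (↭-sym (++-assoc S T U))

++-swapʳ : ∀ (T W U : List Atom) → (T ++ W) ++ U ↭ (T ++ U) ++ W
++-swapʳ T W U = begin
  (T ++ W) ++ U  ↭⟨ ++-assoc T W U ⟩
  T ++ (W ++ U)  ↭⟨ ++⁺ˡ T (++-comm W U) ⟩
  T ++ (U ++ W)  ↭⟨ ↭-sym (++-assoc T U W) ⟩
  (T ++ U) ++ W  ∎
  where open PermutationReasoning

-- Definitionally equal to Conseq B T (φ ∷ ψ ∷ []) χ.
Conseq₂ : Base → List Atom → Formula → Formula → Formula → Set₁
Conseq₂ B T φ ψ χ = ∀ (Y : Base) → Y ⊇ B → ∀ (W : List Atom) → Sup₂ Y W φ ψ → Sup Y (T ++ W) χ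

Conseq₂-map : ∀ {B X T U φ ψ} χ ξ → X ⊇ B →
              (∀ (Y : Base) → Y ⊇ X → ∀ (V : List Atom) → Sup Y V χ → Sup Y (V ++ U) ξ) →
              Conseq₂ B T φ ψ χ → Conseq₂ X (T ++ U) φ ψ ξ
Conseq₂-map {T = T} {U} χ ξ e f c Y g W w =
  Sup-resp-↭ ξ (++-swapʳ T W U) (f Y g (T ++ W) (c Y (⊇-trans g e) W w))

⊗-elim : ∀ {B S T φ ψ} χ → Sup B S (φ ⊗ ψ) → Conseq₂ B T φ ψ χ → Sup B (S ++ T) χ
⊗-elim {B} {T = T} (atom p) s c = s B ⊇-refl T p c
⊗-elim {S = S} {T} (χ ⊗ ξ) s c X e U p k =
  reassoc S T U (atom p) (s X e (T ++ U) p (Conseq₂-map (χ ⊗ ξ) (atom p) e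
    (λ Y f V t → t Y ⊇-refl U p (λ Z g → k Z (⊇-trans g f))) c))
⊗-elim {S = S} {T} I s c X e U p k =
  reassoc S T U (atom p) (s X e (T ++ U) p (Conseq₂-map I (atom p) e
    (λ Y f V t → t Y ⊇-refl U p (Sup-mono (atom p) f k)) c))
⊗-elim {S = S} {T} {φ} {ψ} (χ ⊸ ξ) s c X e U k =
  reassoc S T U ξ (⊗-elim ξ (Sup-mono (φ ⊗ ψ) e s) (Conseq₂-map (χ ⊸ ξ) ξ e
    (λ Y f V t → t Y ⊇-refl U (Sup-mono χ f k)) c))

lemma2 : (B : Base) (S T : List Atom) (φ ψ χ : Formula) →
         Sup B S (φ ⊗ ψ) → Conseq B T (φ ∷ ψ ∷ []) χ → Sup B (S ++ T) χ
lemma2 B S T φ ψ χ = ⊗-elim χ
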